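{- Let $G$ be a restricted $k$-degenerate graph with maximum degree $\Delta$. Then $\chi_i(G) \leq \Delta + k + 2$.
   Context: A graph $G$ is $k$-degenerate if its vertices can be ordered $v_1, v_2, \dots, v_n$ so that each $v_i$ has degree at most $k$ in the induced subgraph $G[\{v_1,\dots,v_i\}]$. It is a restricted $k$-degenerate graph if moreover such an ordering can be chosen so that for every $i$ the subgraph induced by $N(v_i)\cap\{v_1,\dots,v_{i-1}\}$ is complete. For a graph $G$, let $D(G)$ be the digraph obtained by replacing each edge $uv$ by the two opposite arcs $uv$ and $vu$, with arc set $A(G)$. Two distinct arcs $uv$ and $xy$ are adjacent if $u=x$, or $v=x$, or $y=u$. An incidence coloring is a map $\sigma: A(G)\to C$ assigning distinct colors to adjacent arcs; the incidence chromatic number $\chi_i(G)$ is the minimum $|C|$ over all incidence colorings. -}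

module Defs where

open import Data.Nat using (ℕ; _+_; _≤_; _⊔_)
open import Data.Fin using (Fin; _<_; _<?_)
open import Data.Bool using (Bool; true; false; T; if_then_else_)
open import Data.List using (List; map; foldr; allFin)
open import Data.Nat.ListAction using (sum)
open import Data.Product using (Σ; _×_; _,_)
open import Data.Sum using (_⊎_)
open import Relation.Nullary using (¬_; does)
open import Relation.Binary.PropositionalEquality using (_≡_; _≢_)
open import Function.Definitions using (Injective)

record Graph (n : ℕ) : Set where
  field
    adj    : Fin n → Fin n → Bool
    sym    : ∀ u v → adj u v ≡ adj v u
    irrefl : ∀ v → adj v v ≡ false

module _ {n : ℕ} (G : Graph n) where
  open Graph G

  Adj : Fin n → Fin n → Set
  Adj u v = T (adj u v)

  degree : Fin n → ℕ
  degree v = sum (map (λ u → if adj v u then 1 else 0) (allFin n))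

  maxDegree : ℕ
  maxDegree = foldr _⊔_ 0 (map degree (allFin n))

  -- An ordering v_1,...,v_n of the vertices is given by an injective
  -- position map pos : Fin n → Fin n (pos v = index of v in the ordering).
  backDegree : (Fin n → Fin n) → Fin n → ℕ
  backDegree pos v =
    sum (map (λ u → if adj v u then (if does (pos u <? pos v) then 1 else 0) else 0) (allFin n))

  RestrictedDegenerate : ℕ → Set
  RestrictedDegenerate k =
    Σ (Fin n → Fin n) λ pos →
      Injective _≡_ _≡_ pos
      × (∀ v → backDegree pos v ≤ k)
      × (∀ v u w → Adj v u → Adj v w → pos u < pos v → pos w < pos v →
           u ≢ w → Adj u w)

  -- Arcs of D(G): ordered pairs (u , v) with uv an edge.
  -- Two distinct arcs uv, xy are adjacent if u = x, or v = x, or y = u.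
  ArcsAdjacent : Fin n → Fin n → Fin n → Fin n → Set
  ArcsAdjacent u v x y =
    ¬ (u ≡ x × v ≡ y) × (u ≡ x ⊎ v ≡ x ⊎ y ≡ u)

  IsIncidenceColoring : (c : ℕ) → ((u v : Fin n) → Adj u v → Fin c) → Set
  IsIncidenceColoring c σ =
    ∀ u v x y (e : Adj u v) (f : Adj x y) →
      ArcsAdjacent u v x y → σ u v e ≢ σ x y f

  IncidenceChromatic≤ : ℕ → Set
  IncidenceChromatic≤ c =
    Σ ((u v : Fin n) → Adj u v → Fin c) (IsIncidenceColoring c)

-- Order the vertices by the restricted degeneracy ordering and call an arc uv forward when u
-- precedes v. Colour forward arcs from a palette of Δ + 1 colours and give a backward arc uv the
-- colour of its head v in a proper vertex colouring with k + 1 colours. Two adjacent backward arcs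
-- have adjacent heads: either one head is the other arc's tail, or both are earlier neighbours of
-- the common tail and hence adjacent by the clique condition. Both auxiliary colourings are
-- greedy along the ordering: a vertex sees at most k coloured earlier neighbours, and a forward
-- arc uv, coloured when its head v is reached, only has to avoid the at most Δ arcs at u.
module Submission where

open import Defs
open import Data.Nat using (ℕ; zero; suc; s≤s; _+_; _≤_; _<_; _⊔_; _≟_)
open import Data.Nat.Properties
  using (<-irrefl; m<1+n⇒m≤n; ≤∧≢⇒<; ≮⇒≥; ≤-trans; ≤-reflexive; m≤m⊔n; m≤n⊔m; +-suc; +-comm)
open import Data.Nat.ListAction using (sum)
open import Data.Fin using (Fin; toℕ; join; splitAt; _<?_)
  renaming (zero to fzero; _<_ to _<ᶠ_; _≟_ to _≟ᶠ_)
open import Data.Fin.Properties using (<-asym; toℕ<n; toℕ-injective; pigeonhole; ¬∀⟶∃¬; splitAt-join)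
open import Data.Bool using (Bool; true; false; T; if_then_else_; _∧_)
open import Data.Bool.Properties using (T-∧)
open import Data.List using (List; []; _∷_; length; map; foldr; allFin; filterᵇ; lookup)
open import Data.List.Properties using (length-map; map-cong)
open import Data.List.Relation.Unary.Any using (here; there; index; any?)
open import Data.List.Relation.Unary.Any.Properties using (lookup-index)
open import Data.List.Membership.Propositional using (_∈_; _∉_)
open import Data.List.Membership.Propositional.Properties using (∈-allFin; ∈-map⁺; ∈-filter⁺)
open import Data.Product using (Σ; ∃; _×_; _,_; proj₁; proj₂)
open import Data.Sum using (_⊎_; inj₁; inj₂)
open import Data.Sum.Properties using (inj₁-injective; inj₂-injective)
open import Function using (_∘_)
open import Function.Bundles using (Equivalence)
open import Function.Definitions using (Injective)
open import Relation.Nullary using (¬_; yes; no; does; contradiction)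
open import Relation.Nullary.Decidable using (T?; dec-true; dec-false)
open import Relation.Binary.PropositionalEquality

length<⇒∃∉ : ∀ {m} (L : List (Fin m)) → length L < m → ∃ (_∉ L)
length<⇒∃∉ {m} L |L|<m = ¬∀⟶∃¬ m (_∈ L) (λ c → any? (c ≟ᶠ_) L) not-all-in
  where
  not-all-in : ¬ (∀ c → c ∈ L)
  not-all-in all-in with i , j , i<j , same-index ← pigeonhole |L|<m (index ∘ all-in)
    = <-irrefl (cong toℕ i≡j) i<j
    where
    i≡j : i ≡ j
    i≡j = trans (lookup-index (all-in i))
            (trans (cong (lookup L) same-index) (sym (lookup-index (all-in j))))

length-filterᵇ : ∀ {A : Set} (p : A → Bool) xs →
  length (filterᵇ p xs) ≡ sum (map (λ x → if p x then 1 else 0) xs)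
length-filterᵇ p [] = refl
length-filterᵇ p (x ∷ xs) with p x
... | true  = cong suc (length-filterᵇ p xs)
... | false = length-filterᵇ p xs

≤-foldr-⊔ : ∀ {x xs} → x ∈ xs → x ≤ foldr _⊔_ 0 xs
≤-foldr-⊔ {x} (here refl) = m≤m⊔n x _
≤-foldr-⊔ {xs = y ∷ _} (there x∈xs) = ≤-trans (≤-foldr-⊔ x∈xs) (m≤n⊔m y _)

join-injective : ∀ a b → Injective _≡_ _≡_ (join a b)
join-injective a b {x} {y} join≡ =
  trans (sym (splitAt-join a b x)) (trans (cong (splitAt a) join≡) (splitAt-join a b y))

m<1+n∧m≢n⇒m<n : ∀ {m n} → m < suc n → m ≢ n → m < n
m<1+n∧m≢n⇒m<n m<1+n = ≤∧≢⇒< (m<1+n⇒m≤n m<1+n)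

Proper : {I C : Set} → (I → I → Set) → (I → C) → Set
Proper Conflict col = ∀ {a b} → Conflict a b → col a ≢ col b

-- Greedy colouring of the items of I stage by stage in order of rank. Items of equal rank never
-- conflict, so a whole stage is coloured at once; each item avoids the forbidden colours computed
-- from the current colouring, which must include those of its conflicting items of smaller rank.
module Greedy {I : Set} (rank : I → ℕ) (stages : ℕ) (rank<stages : ∀ a → rank a < stages)
  (Conflict : I → I → Set)
  (conflict-sym : ∀ {a b} → Conflict a b → Conflict b a)
  (conflict-rank : ∀ {a b} → Conflict a b → rank a ≢ rank b)
  {m : ℕ} (forbidden : (I → Fin (suc m)) → I → List (Fin (suc m)))
  (length-forbidden : ∀ col a → length (forbidden col a) ≤ m)
  (forbidden-complete : ∀ col {a b} → Conflict a b → rank b < rank a → col b ∈ forbidden col a)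
  where

  ProperBelow : ℕ → (I → Fin (suc m)) → Set
  ProperBelow i col = ∀ {a b} → Conflict a b → rank a < i → rank b < i → col a ≢ col b

  freshColour : (I → Fin (suc m)) → I → Fin (suc m)
  freshColour col a = proj₁ (length<⇒∃∉ (forbidden col a) (s≤s (length-forbidden col a)))

  freshColour-avoids : ∀ col {a b} → Conflict a b → rank b < rank a → freshColour col a ≢ col b
  freshColour-avoids col {a} ab b<a fresh≡ =
    proj₂ (length<⇒∃∉ (forbidden col a) (s≤s (length-forbidden col a)))
      (subst (_∈ forbidden col a) (sym fresh≡) (forbidden-complete col ab b<a))

  recolourStage : ℕ → (I → Fin (suc m)) → I → Fin (suc m)
  recolourStage i col a with rank a ≟ i
  ... | yes _ = freshColour col a
  ... | no  _ = col a

  recolourStage-proper : ∀ i col → ProperBelow i col → ProperBelow (suc i) (recolourStage i col)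
  recolourStage-proper i col proper {a} {b} ab a<1+i b<1+i with rank a ≟ i | rank b ≟ i
  ... | yes a≡i | yes b≡i = λ _ → conflict-rank ab (trans a≡i (sym b≡i))
  ... | yes a≡i | no  b≢i =
    freshColour-avoids col ab (subst (rank b <_) (sym a≡i) (m<1+n∧m≢n⇒m<n b<1+i b≢i))
  ... | no  a≢i | yes b≡i =
    freshColour-avoids col (conflict-sym ab) (subst (rank a <_) (sym b≡i) (m<1+n∧m≢n⇒m<n a<1+i a≢i))
      ∘ sym
  ... | no  a≢i | no  b≢i = proper ab (m<1+n∧m≢n⇒m<n a<1+i a≢i) (m<1+n∧m≢n⇒m<n b<1+i b≢i)

  properBelow : ∀ i → Σ (I → Fin (suc m)) (ProperBelow i)
  properBelow zero = (λ _ → fzero) , λ _ ()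
  properBelow (suc i) with col , proper ← properBelow i =
    recolourStage i col , recolourStage-proper i col proper

  greedyColouring : Σ (I → Fin (suc m)) (Proper Conflict)
  greedyColouring with col , proper ← properBelow stages =
    col , λ ab → proper ab (rank<stages _) (rank<stages _)

module _ {n : ℕ} (G : Graph n) where
  open Graph G using (adj) renaming (sym to adj-sym; irrefl to adj-irrefl)

  Adj-sym : ∀ {u v} → Adj G u v → Adj G v u
  Adj-sym {u} {v} = subst T (adj-sym u v)

  Adj⇒≢ : ∀ {u v} → Adj G u v → u ≢ v
  Adj⇒≢ {u} uv refl = subst T (adj-irrefl u) uv

  ArcsAdjacent-sym : ∀ {u v x y} → ArcsAdjacent G u v x y → ArcsAdjacent G x y u v
  ArcsAdjacent-sym (distinct , shared) =
    (λ (x≡u , y≡v) → distinct (sym x≡u , sym y≡v)) , swap-shared shared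
    where
    swap-shared : ∀ {u v x y : Fin n} → u ≡ x ⊎ v ≡ x ⊎ y ≡ u → x ≡ u ⊎ y ≡ u ⊎ v ≡ x
    swap-shared (inj₁ u≡x)        = inj₁ (sym u≡x)
    swap-shared (inj₂ (inj₁ v≡x)) = inj₂ (inj₂ v≡x)
    swap-shared (inj₂ (inj₂ y≡u)) = inj₂ (inj₁ y≡u)

  neighbours : Fin n → List (Fin n)
  neighbours v = filterᵇ (adj v) (allFin n)

  length-neighbours : ∀ v → length (neighbours v) ≡ degree G v
  length-neighbours v = length-filterᵇ (adj v) (allFin n)

  ∈-neighbours : ∀ {u v} → Adj G v u → u ∈ neighbours v
  ∈-neighbours {u} vu = ∈-filter⁺ (T? ∘ adj _) (∈-allFin u) vu

  degree≤maxDegree : ∀ v → degree G v ≤ maxDegree G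
  degree≤maxDegree v = ≤-foldr-⊔ (∈-map⁺ (degree G) (∈-allFin v))

  EarlierNeighboursClique : (Fin n → Fin n) → Set
  EarlierNeighboursClique pos = ∀ v u w → Adj G v u → Adj G v w →
    pos u <ᶠ pos v → pos w <ᶠ pos v → u ≢ w → Adj G u w

  module _ (pos : Fin n → Fin n) (pos-injective : Injective _≡_ _≡_ pos) where

    toℕ∘pos-injective : ∀ {u v} → toℕ (pos u) ≡ toℕ (pos v) → u ≡ v
    toℕ∘pos-injective = pos-injective ∘ toℕ-injective

    Adj⇒≮⇒> : ∀ {u v} → Adj G u v → ¬ pos u <ᶠ pos v → pos v <ᶠ pos u
    Adj⇒≮⇒> uv u≮v = ≤∧≢⇒< (≮⇒≥ u≮v) (Adj⇒≢ uv ∘ sym ∘ toℕ∘pos-injective)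

    earlierNeighbours : Fin n → List (Fin n)
    earlierNeighbours v = filterᵇ (λ u → adj v u ∧ does (pos u <? pos v)) (allFin n)

    length-earlierNeighbours : ∀ v → length (earlierNeighbours v) ≡ backDegree G pos v
    length-earlierNeighbours v =
      trans (length-filterᵇ _ (allFin n)) (sym (cong sum (map-cong nested-if≡if-∧ (allFin n))))
      where
      nested-if≡if-∧ : ∀ u → (if adj v u then (if does (pos u <? pos v) then 1 else 0) else 0)
                           ≡ (if adj v u ∧ does (pos u <? pos v) then 1 else 0)
      nested-if≡if-∧ u with adj v u
      ... | true  = refl
      ... | false = refl

    ∈-earlierNeighbours : ∀ {u v} → Adj G v u → pos u <ᶠ pos v → u ∈ earlierNeighbours v
    ∈-earlierNeighbours {u} {v} vu u<v =
      ∈-filter⁺ (T? ∘ _) (∈-allFin u)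
        (Equivalence.from T-∧ (vu , subst T (sym (dec-true (pos u <? pos v) u<v)) _))

    vertexColouring : ∀ {k} → (∀ v → backDegree G pos v ≤ k) →
      Σ (Fin n → Fin (suc k)) (Proper (Adj G))
    vertexColouring backDegree≤k = Greedy.greedyColouring (toℕ ∘ pos) n (toℕ<n ∘ pos)
      (Adj G) Adj-sym (λ uv → Adj⇒≢ uv ∘ toℕ∘pos-injective)
      (λ c v → map c (earlierNeighbours v))
      (λ c v → ≤-trans
        (≤-reflexive (trans (length-map c (earlierNeighbours v)) (length-earlierNeighbours v)))
        (backDegree≤k v))
      (λ c vu u<v → ∈-map⁺ c (∈-earlierNeighbours vu u<v))

    Forward : Fin n → Fin n → Set
    Forward u v = Adj G u v × pos u <ᶠ pos v

    ForwardConflict : Fin n × Fin n → Fin n × Fin n → Set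
    ForwardConflict (u , v) (x , y) = Forward u v × Forward x y × ArcsAdjacent G u v x y

    ForwardConflict-sym : ∀ {a b} → ForwardConflict a b → ForwardConflict b a
    ForwardConflict-sym (uv , xy , adjacent) = xy , uv , ArcsAdjacent-sym adjacent

    ForwardConflict⇒heads≢ : ∀ {u v x y} → ForwardConflict (u , v) (x , y) →
      toℕ (pos v) ≢ toℕ (pos y)
    ForwardConflict⇒heads≢ ((_ , u<v) , (_ , x<y) , distinct , shared) v≡y
      with refl ← toℕ∘pos-injective v≡y with shared
    ... | inj₁ refl        = distinct (refl , refl)
    ... | inj₂ (inj₁ refl) = <-irrefl refl x<y
    ... | inj₂ (inj₂ refl) = <-irrefl refl u<v

    forwardArc : Fin n → Fin n → Fin n × Fin n
    forwardArc u w = if does (pos u <? pos w) then (u , w) else (w , u)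

    forwardArc-< : ∀ {u w} → pos u <ᶠ pos w → forwardArc u w ≡ (u , w)
    forwardArc-< {u} {w} u<w rewrite dec-true (pos u <? pos w) u<w = refl

    forwardArc-> : ∀ {u w} → pos w <ᶠ pos u → forwardArc u w ≡ (w , u)
    forwardArc-> {u} {w} w<u rewrite dec-false (pos u <? pos w) (<-asym w<u) = refl

    -- An earlier-coloured forward arc in conflict with uv cannot start at v, so it meets u.
    earlierConflict-atTail : ∀ {u v x y} → ForwardConflict (u , v) (x , y) →
      pos y <ᶠ pos v → ∃ λ w → Adj G u w × forwardArc u w ≡ (x , y)
    earlierConflict-atTail {y = y} (_ , (xy , x<y) , _ , inj₁ refl) _ = y , xy , forwardArc-< x<y
    earlierConflict-atTail (_ , (_ , x<y) , _ , inj₂ (inj₁ refl)) y<v =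
      contradiction x<y (<-asym y<v)
    earlierConflict-atTail {x = x} (_ , (xy , x<y) , _ , inj₂ (inj₂ refl)) _ =
      x , Adj-sym xy , forwardArc-> x<y

    forwardArcColouring :
      Σ (Fin n × Fin n → Fin (suc (maxDegree G))) (Proper ForwardConflict)
    forwardArcColouring = Greedy.greedyColouring (toℕ ∘ pos ∘ proj₂) n (toℕ<n ∘ pos ∘ proj₂)
      ForwardConflict ForwardConflict-sym ForwardConflict⇒heads≢
      (λ c (u , _) → map (c ∘ forwardArc u) (neighbours u))
      (λ c (u , _) → ≤-trans
        (≤-reflexive (trans (length-map _ (neighbours u)) (length-neighbours u)))
        (degree≤maxDegree u))
      (λ c conflict y<v → colour-at-tail c (earlierConflict-atTail conflict y<v))
      where
      colour-at-tail : ∀ c {u a} → ∃ (λ w → Adj G u w × forwardArc u w ≡ a) →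
        c a ∈ map (c ∘ forwardArc u) (neighbours u)
      colour-at-tail c (w , uw , refl) = ∈-map⁺ (c ∘ forwardArc _) (∈-neighbours uw)

    backwardHeads-adjacent : EarlierNeighboursClique pos → ∀ {u v x y} → Adj G u v → Adj G x y →
      pos v <ᶠ pos u → pos y <ᶠ pos x → ArcsAdjacent G u v x y → Adj G v y
    backwardHeads-adjacent clique {u} {v} {y = y} uv uy v<u y<u (distinct , inj₁ refl) =
      clique u v y uv uy v<u y<u (λ v≡y → distinct (refl , v≡y))
    backwardHeads-adjacent _ _  xy _ _ (_ , inj₂ (inj₁ refl)) = xy
    backwardHeads-adjacent _ uv _  _ _ (_ , inj₂ (inj₂ refl)) = Adj-sym uv

    incidenceColouring : ∀ {a b} → EarlierNeighboursClique pos →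
      Σ (Fin n × Fin n → Fin a) (Proper ForwardConflict) →
      Σ (Fin n → Fin b) (Proper (Adj G)) →
      IncidenceChromatic≤ G (a + b)
    incidenceColouring {a} {b} clique (fc , fc-proper) (vc , vc-proper) =
      (λ u v _ → join a b (colour u v)) ,
      λ u v x y uv xy adjacent → colour-proper uv xy adjacent ∘ join-injective a b
      where
      colour : Fin n → Fin n → Fin a ⊎ Fin b
      colour u v with pos u <? pos v
      ... | yes _ = inj₁ (fc (u , v))
      ... | no  _ = inj₂ (vc v)

      colour-proper : ∀ {u v x y} → Adj G u v → Adj G x y → ArcsAdjacent G u v x y →
        colour u v ≢ colour x y
      colour-proper {u} {v} {x} {y} uv xy adjacent with pos u <? pos v | pos x <? pos y
      ... | yes u<v | yes x<y = fc-proper ((uv , u<v) , (xy , x<y) , adjacent) ∘ inj₁-injective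
      ... | yes _   | no  _   = λ ()
      ... | no  _   | yes _   = λ ()
      ... | no  u≮v | no  x≮y = vc-proper (backwardHeads-adjacent clique uv xy
                                  (Adj⇒≮⇒> uv u≮v) (Adj⇒≮⇒> xy x≮y) adjacent) ∘ inj₂-injective

corollary2p3 : (n k : ℕ) (G : Graph n) → RestrictedDegenerate G k →
    IncidenceChromatic≤ G (maxDegree G + k + 2)
corollary2p3 n k G (pos , pos-injective , backDegree≤k , clique) =
  subst (IncidenceChromatic≤ G) palette-size
    (incidenceColouring G pos pos-injective clique
      (forwardArcColouring G pos pos-injective)
      (vertexColouring G pos pos-injective backDegree≤k))
  where
  palette-size : suc (maxDegree G) + suc k ≡ maxDegree G + k + 2
  palette-size = trans (cong suc (+-suc (maxDegree G) k)) (+-comm 2 (maxDegree G + k))
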